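{- Let $m\ge 1$ and let $G^c=(V,E)$ be the cocktail party graph on $2m$ vertices, i.e. the graph obtained from the complete graph $K_{2m}$ by deleting the edges of a perfect matching. For every coloring of $E$ with two colors $1,2$ (giving spanning subgraphs $G^c_1=(V,E_1)$ and $G^c_2=(V,E_2)$, where $E=E_1\cup E_2$, $E_1\cap E_2=\emptyset$), there exist $A,B\subseteq V$ and colors $i,j\in\{1,2\}$ such that $A\cup B=V$, $A$ is a 2-reachable subset of $G^c_i$, and $B$ is a 2-reachable subset of $G^c_j$.
   Context: A subset $X$ of the vertex set of a graph $H$ is a 2-reachable subset of $H$ if any two vertices of $X$ are at distance at most two in $H$ (the connecting path may use vertices outside $X$). Here $G^c_i$ denotes the spanning subgraph of $G^c$ consisting of all edges of color $i$. -}

module Defs where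

open import Data.Nat using (ℕ)
open import Data.Fin using (Fin)
open import Data.Bool using (Bool; true)
open import Data.Product using (_×_; proj₁; ∃)
open import Data.Sum using (_⊎_)
open import Relation.Binary.PropositionalEquality using (_≡_)
open import Relation.Nullary using (¬_)

-- Vertices of the cocktail party graph on 2m vertices: pairs (k , b),
-- k : Fin m indexes the deleted perfect-matching edge {(k,false),(k,true)}.
CPVertex : ℕ → Set
CPVertex m = Fin m × Bool

CPAdj : (m : ℕ) → CPVertex m → CPVertex m → Set
CPAdj m u v = ¬ (proj₁ u ≡ proj₁ v)

-- A 2-edge-colouring of the cocktail party graph: a colour (Fin 2) for each
-- ordered pair of vertices, required to be symmetric on edges so that it is
-- a colouring of undirected edges (values on non-edges are irrelevant).
record TwoColouring (m : ℕ) : Set where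
  field
    colour : CPVertex m → CPVertex m → Fin 2
    symmetric : ∀ u v → CPAdj m u v → colour u v ≡ colour v u

open TwoColouring public

ColAdj : {m : ℕ} → TwoColouring m → Fin 2 → CPVertex m → CPVertex m → Set
ColAdj {m} c i u v = CPAdj m u v × colour c u v ≡ i

Dist≤2 : {m : ℕ} → TwoColouring m → Fin 2 → CPVertex m → CPVertex m → Set
Dist≤2 c i u v =
  u ≡ v ⊎ (ColAdj c i u v ⊎ ∃ λ w → ColAdj c i u w × ColAdj c i w v)

VSubset : ℕ → Set
VSubset m = CPVertex m → Bool

TwoReachable : {m : ℕ} → TwoColouring m → Fin 2 → VSubset m → Set
TwoReachable c i X =
  ∀ u v → X u ≡ true → X v ≡ true → Dist≤2 c i u v

{-# OPTIONS --safe #-}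
module Submission where

-- Fix a matching pair x, x'.  If no vertex is joined to both x and x' in colour i, the stars of
-- x and of x' in the other colour cover V.  Otherwise x, x' are at i-distance 2, so the i-star of
-- x together with x' is 2-reachable in colour i, and with the other star of x it covers V unless some z is
-- joined to x in colour i and to x' in the other colour but is at i-distance > 2 from x'; call
-- such z a blocker of (x, i).  The blockers of (y, 1) and (y, 2) always form a matching pair, since
-- an edge between them of either colour would be a short path to y'.  So if this fails for x and
-- x' in both colours, the blockers of x form a pair {z₁, z₂} and those of x' a pair {z₃, z₄}.
-- If the two pairs coincide, then every vertex outside them is joined in colour 1 to both of x, x'
-- or to both of z₁, z₂, and these two pairs with their common 1-neighbours cover V.  Otherwise the
-- 2-blocker z₄ of x' has no blocker of its own in colour 2, and the construction succeeds at z₄.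

open import Defs
open import Data.Nat using (ℕ; suc; _≥_)
open import Data.Fin using (Fin; zero; suc; _≟_)
open import Data.Fin.Properties using (any?)
open import Data.Bool using (true; false; not)
import Data.Bool.Properties as Bool
open import Data.Product using (Σ; _×_; _,_; proj₁; proj₂; ∃; map₂; swap)
open import Data.Product.Properties using (≡-dec)
open import Data.Sum using (_⊎_; inj₁; inj₂; [_,_])
import Data.Sum as Sum
open import Data.Empty using (⊥; ⊥-elim)
open import Function using (_∘_)
open import Level using (0ℓ)
open import Relation.Binary.PropositionalEquality
  using (_≡_; _≢_; refl; sym; trans; subst; ≢-sym)
open import Relation.Nullary using (¬_; Dec; yes; no; does)
open import Relation.Nullary.Decidable
  using (_×-dec_; _⊎-dec_; ¬?; map′; dec-true; decidable-stable)
open import Relation.Unary using (Pred; Decidable; _∪_; _∩_; ｛_｝)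
open import Relation.Unary.Properties using (_∪?_; _∩?_; ∁?)

other : Fin 2 → Fin 2
other zero = suc zero
other (suc zero) = zero

other-involutive : ∀ i → other (other i) ≡ i
other-involutive zero = refl
other-involutive (suc zero) = refl

≢-other : ∀ i → i ≢ other i
≢-other zero ()
≢-other (suc zero) ()

≡-or-other : ∀ a i → a ≡ i ⊎ a ≡ other i
≡-or-other zero zero = inj₁ refl
≡-or-other zero (suc zero) = inj₂ refl
≡-or-other (suc zero) zero = inj₂ refl
≡-or-other (suc zero) (suc zero) = inj₁ refl

-- a, a' are the colours of the edges from some v to x, x', and b, b' those from v to p, p';
-- each hypothesis says that v is not a common neighbour, in one colour, of a vertex of each pair.
two-pairs-profile : ∀ i a a' b b' →
  ¬ (b ≡ i × a' ≡ i) → ¬ (b ≡ other i × a ≡ other i) →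
  ¬ (b' ≡ other i × a' ≡ other i) → ¬ (b' ≡ i × a ≡ i) →
  (a ≡ i × a' ≡ i) ⊎ (b ≡ i × b' ≡ i)
two-pairs-profile i a a' b b' h₁ h₂ h₃ h₄
  with ≡-or-other a i | ≡-or-other a' i | ≡-or-other b i | ≡-or-other b' i
... | inj₁ a≡i | inj₁ a'≡i | _ | _ = inj₁ (a≡i , a'≡i)
... | _ | _ | inj₁ b≡i | inj₁ b'≡i = inj₂ (b≡i , b'≡i)
... | inj₂ a≡o | _ | inj₂ b≡o | _ = ⊥-elim (h₂ (b≡o , a≡o))
... | _ | inj₁ a'≡i | inj₁ b≡i | _ = ⊥-elim (h₁ (b≡i , a'≡i))
... | _ | inj₂ a'≡o | _ | inj₂ b'≡o = ⊥-elim (h₃ (b'≡o , a'≡o))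
... | inj₁ a≡i | _ | _ | inj₁ b'≡i = ⊥-elim (h₄ (b'≡i , a≡i))

module _ {m : ℕ} where

  partner : CPVertex m → CPVertex m
  partner (k , b) = k , not b

  same-pair : (u v : CPVertex m) → proj₁ u ≡ proj₁ v → v ≡ u ⊎ v ≡ partner u
  same-pair (k , false) (.k , false) refl = inj₁ refl
  same-pair (k , false) (.k , true) refl = inj₂ refl
  same-pair (k , true) (.k , false) refl = inj₂ refl
  same-pair (k , true) (.k , true) refl = inj₁ refl

  _≟V_ : (u v : CPVertex m) → Dec (u ≡ v)
  _≟V_ = ≡-dec _≟_ Bool._≟_

  CPAdj? : (u v : CPVertex m) → Dec (CPAdj m u v)
  CPAdj? u v = ¬? (proj₁ u ≟ proj₁ v)

  any-vertex? : {P : Pred (CPVertex m) 0ℓ} → Decidable P → Dec (∃ P)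
  any-vertex? {P} P? = map′ from to (any? λ k → P? (k , false) ⊎-dec P? (k , true))
    where
    from : ∃ (λ k → P (k , false) ⊎ P (k , true)) → ∃ P
    from (k , inj₁ p) = _ , p
    from (k , inj₂ p) = _ , p
    to : ∃ P → ∃ (λ k → P (k , false) ⊎ P (k , true))
    to ((k , false) , p) = k , inj₁ p
    to ((k , true) , p) = k , inj₂ p

module _ {m : ℕ} (c : TwoColouring m) where

  private
    V : Set
    V = CPVertex m

  ColAdj? : ∀ i u v → Dec (ColAdj c i u v)
  ColAdj? i u v = CPAdj? u v ×-dec (colour c u v ≟ i)

  ColAdj-sym : ∀ {i u v} → ColAdj c i u v → ColAdj c i v u
  ColAdj-sym {u = u} {v} (u≁v , uv) = ≢-sym u≁v , trans (sym (symmetric c u v u≁v)) uv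

  different-colours⇒≢ : ∀ {i y u v} → colour c y u ≡ i → colour c y v ≡ other i → u ≢ v
  different-colours⇒≢ {i} yu yv refl = ≢-other i (trans (sym yu) yv)

  edge : ∀ {i u v} → ColAdj c i u v → Dist≤2 c i u v
  edge = inj₂ ∘ inj₁

  two-step : ∀ {i u w v} → ColAdj c i u w → ColAdj c i w v → Dist≤2 c i u v
  two-step uw wv = inj₂ (inj₂ (_ , uw , wv))

  Dist≤2-sym : ∀ {i u v} → Dist≤2 c i u v → Dist≤2 c i v u
  Dist≤2-sym (inj₁ u≡v) = inj₁ (sym u≡v)
  Dist≤2-sym (inj₂ (inj₁ uv)) = edge (ColAdj-sym uv)
  Dist≤2-sym (inj₂ (inj₂ (_ , uw , wv))) = two-step (ColAdj-sym wv) (ColAdj-sym uw)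

  Dist≤2? : ∀ i u v → Dec (Dist≤2 c i u v)
  Dist≤2? i u v =
    u ≟V v ⊎-dec ColAdj? i u v ⊎-dec any-vertex? (λ w → ColAdj? i u w ×-dec ColAdj? i w v)

  no-common-neighbour : ∀ {i u v w} → ¬ Dist≤2 c i u w → ColAdj c i u v → ColAdj c i w v → ⊥
  no-common-neighbour far uv wv = far (two-step uv (ColAdj-sym wv))

  TwoReachablePred : Fin 2 → Pred V 0ℓ → Set
  TwoReachablePred i P = ∀ {u v} → P u → P v → Dist≤2 c i u v

  TwoReachableCover : Set
  TwoReachableCover =
    Σ (VSubset m) λ A → Σ (VSubset m) λ B → Σ (Fin 2) λ i → Σ (Fin 2) λ j →
      (∀ v → A v ≡ true ⊎ B v ≡ true) × TwoReachable c i A × TwoReachable c j B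

  decidable-cover : ∀ {P Q} → Decidable P → Decidable Q → ∀ i j →
    (∀ v → P v ⊎ Q v) → TwoReachablePred i P → TwoReachablePred j Q → TwoReachableCover
  decidable-cover P? Q? i j covers P-reachable Q-reachable =
    (does ∘ P?) , (does ∘ Q?) , i , j ,
    (λ v → Sum.map (dec-true (P? v)) (dec-true (Q? v)) (covers v)) ,
    (λ u v Pu Pv → P-reachable (witness (P? u) Pu) (witness (P? v) Pv)) ,
    (λ u v Qu Qv → Q-reachable (witness (Q? u) Qu) (witness (Q? v) Qv))
    where
    witness : ∀ {A : Set} (a? : Dec A) → does a? ≡ true → A
    witness (yes a) _ = a
    witness (no _) ()

  Star : V → Fin 2 → Pred V 0ℓ
  Star y i = ｛ y ｝ ∪ ColAdj c i y

  Star? : ∀ y i → Decidable (Star y i)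
  Star? y i = (y ≟V_) ∪? ColAdj? i y

  star-reachable : ∀ {y i} → TwoReachablePred i (Star y i)
  star-reachable (inj₁ refl) (inj₁ refl) = inj₁ refl
  star-reachable (inj₁ refl) (inj₂ yv) = edge yv
  star-reachable (inj₂ yu) (inj₁ refl) = edge (ColAdj-sym yu)
  star-reachable (inj₂ yu) (inj₂ yv) = two-step (ColAdj-sym yu) yv

  PairNeighbour : V → Fin 2 → Fin 2 → Pred V 0ℓ
  PairNeighbour y i j = ColAdj c i y ∩ ColAdj c j (partner y)

  PairNeighbour? : ∀ y i j → Decidable (PairNeighbour y i j)
  PairNeighbour? y i j = ColAdj? i y ∩? ColAdj? j (partner y)

  PairAndCommon : V → Fin 2 → Pred V 0ℓ
  PairAndCommon y i v = proj₁ y ≡ proj₁ v ⊎ PairNeighbour y i i v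

  PairAndCommon? : ∀ y i → Decidable (PairAndCommon y i)
  PairAndCommon? y i v = proj₁ y ≟ proj₁ v ⊎-dec PairNeighbour? y i i v

  pair-sees-common : ∀ {y i u t} → proj₁ y ≡ proj₁ u → PairNeighbour y i i t → ColAdj c i u t
  pair-sees-common {y} {u = u} same (yt , y't) with same-pair y u same
  ... | inj₁ refl = yt
  ... | inj₂ refl = y't

  pair-and-common-reachable : ∀ {y i} → ∃ (PairNeighbour y i i) → TwoReachablePred i (PairAndCommon y i)
  pair-and-common-reachable (t , common) (inj₁ su) (inj₁ sv) =
    two-step (pair-sees-common su common) (ColAdj-sym (pair-sees-common sv common))
  pair-and-common-reachable _ (inj₁ su) (inj₂ cv) = edge (pair-sees-common su cv)
  pair-and-common-reachable _ (inj₂ cu) (inj₁ sv) = edge (ColAdj-sym (pair-sees-common sv cu))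
  pair-and-common-reachable _ (inj₂ (yu , _)) (inj₂ (yv , _)) = two-step (ColAdj-sym yu) yv

  cover-by-stars : ∀ y i → ¬ ∃ (PairNeighbour y i i) → TwoReachableCover
  cover-by-stars y i none =
    decidable-cover (Star? y (other i)) (Star? (partner y) (other i)) (other i) (other i)
      covers star-reachable star-reachable
    where
    covers : ∀ v → Star y (other i) v ⊎ Star (partner y) (other i) v
    covers v with proj₁ y ≟ proj₁ v
    ... | yes same = Sum.map (inj₁ ∘ sym) (inj₁ ∘ sym) (same-pair y v same)
    ... | no y≁v with ≡-or-other (colour c y v) i | ≡-or-other (colour c (partner y) v) i
    ...   | inj₂ yv | _ = inj₁ (inj₂ (y≁v , yv))
    ...   | _ | inj₂ y'v = inj₂ (inj₂ (y≁v , y'v))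
    ...   | inj₁ yv | inj₁ y'v = ⊥-elim (none (v , (y≁v , yv) , (y≁v , y'v)))

  cover-or-pair-neighbour : ∀ y i → TwoReachableCover ⊎ ∃ (PairNeighbour y i i)
  cover-or-pair-neighbour y i with any-vertex? (PairNeighbour? y i i)
  ... | yes common = inj₂ common
  ... | no none = inj₁ (cover-by-stars y i none)

  cover-by-star-and-partner : ∀ y i → ∃ (PairNeighbour y i i) →
    (∀ z → PairNeighbour y i (other i) z → Dist≤2 c i z (partner y)) → TwoReachableCover
  cover-by-star-and-partner y i (t , yt , y't) reaches-partner =
    decidable-cover (Star? y i ∪? (partner y ≟V_)) (Star? y (other i)) i (other i)
      covers star-and-partner-reachable star-reachable
    where
    covers : ∀ v → (Star y i ∪ ｛ partner y ｝) v ⊎ Star y (other i) v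
    covers v with proj₁ y ≟ proj₁ v
    ... | yes same = inj₁ (Sum.map (inj₁ ∘ sym) sym (same-pair y v same))
    ... | no y≁v with ≡-or-other (colour c y v) i
    ...   | inj₁ yv = inj₁ (inj₁ (inj₂ (y≁v , yv)))
    ...   | inj₂ yv = inj₂ (inj₂ (y≁v , yv))
    star-to-partner : ∀ {v} → Star y i v → Dist≤2 c i v (partner y)
    star-to-partner (inj₁ refl) = two-step yt (ColAdj-sym y't)
    star-to-partner {v} (inj₂ (y≁v , yv)) with ≡-or-other (colour c (partner y) v) i
    ... | inj₁ y'v = edge (ColAdj-sym (y≁v , y'v))
    ... | inj₂ y'v = reaches-partner v ((y≁v , yv) , (y≁v , y'v))
    star-and-partner-reachable : TwoReachablePred i (Star y i ∪ ｛ partner y ｝)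
    star-and-partner-reachable (inj₁ su) (inj₁ sv) = star-reachable su sv
    star-and-partner-reachable (inj₁ su) (inj₂ refl) = star-to-partner su
    star-and-partner-reachable (inj₂ refl) (inj₁ sv) = Dist≤2-sym (star-to-partner sv)
    star-and-partner-reachable (inj₂ refl) (inj₂ refl) = inj₁ refl

  cover-unless-blocker : ∀ y i →
    (∀ z → PairNeighbour y i (other i) z → Dist≤2 c i z (partner y)) → TwoReachableCover
  cover-unless-blocker y i reaches-partner with cover-or-pair-neighbour y i
  ... | inj₁ cover = cover
  ... | inj₂ common = cover-by-star-and-partner y i common reaches-partner

  Blocker : V → Fin 2 → Pred V 0ℓ
  Blocker y i z = PairNeighbour y i (other i) z × ¬ Dist≤2 c i z (partner y)

  cover-or-blocker : ∀ y i → ∃ (PairNeighbour y i i) → TwoReachableCover ⊎ ∃ (Blocker y i)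
  cover-or-blocker y i common
    with any-vertex? (PairNeighbour? y i (other i) ∩? ∁? (λ z → Dist≤2? i z (partner y)))
  ... | yes blocker = inj₂ blocker
  ... | no none = inj₁ (cover-by-star-and-partner y i common λ z yz →
                   decidable-stable (Dist≤2? i z (partner y)) λ far → none (z , yz , far))

  far-neighbours-same-pair : ∀ {i u v w} → ColAdj c i v w → ColAdj c (other i) u w →
    ¬ Dist≤2 c i u w → ¬ Dist≤2 c (other i) v w → proj₁ u ≡ proj₁ v
  far-neighbours-same-pair {i} {u} {v} vw uw far-u far-v with proj₁ u ≟ proj₁ v
  ... | yes same = same
  ... | no u≁v with ≡-or-other (colour c u v) i
  ...   | inj₁ uv = ⊥-elim (far-u (two-step (u≁v , uv) vw))
  ...   | inj₂ uv = ⊥-elim (far-v (two-step (ColAdj-sym (u≁v , uv)) uw))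

  blockers-partnered : ∀ {y i z z'} → Blocker y i z → Blocker y (other i) z' → z' ≡ partner z
  blockers-partnered {y} {i} {z} {z'} ((yz , y'z) , far) ((yz' , y'z') , far') =
    Sum.fromInj₂ (λ z'≡z → ⊥-elim (different-colours⇒≢ (proj₂ yz) (proj₂ yz') (sym z'≡z)))
      (same-pair z z' (far-neighbours-same-pair (ColAdj-sym y'z'-in-i) (ColAdj-sym y'z) far far'))
    where
    y'z'-in-i : ColAdj c i (partner y) z'
    y'z'-in-i = subst (λ j → ColAdj c j (partner y) z') (other-involutive i) y'z'

  cover-by-two-pairs : ∀ {x p} i → ColAdj c i x p → ColAdj c i (partner x) (partner p) →
    ¬ Dist≤2 c i p (partner x) → ¬ Dist≤2 c (other i) p x →
    ¬ Dist≤2 c (other i) (partner p) (partner x) → ¬ Dist≤2 c i (partner p) x →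
    ∃ (PairNeighbour x i i) → ∃ (PairNeighbour x (other i) (other i)) → TwoReachableCover
  cover-by-two-pairs {x} {p} i (_ , xp) (_ , x'p') far₁ far₂ far₃ far₄ common
    (t , (x≁t , xt) , (_ , x't)) =
    decidable-cover (PairAndCommon? x i) (PairAndCommon? p i) i i covers
      (pair-and-common-reachable common) (pair-and-common-reachable (t , pt , p't))
    where
    p≁t : CPAdj m p t
    p≁t same = [ different-colours⇒≢ xp xt ∘ sym , different-colours⇒≢ x'p' x't ∘ sym ]
                 (same-pair p t same)
    pt : ColAdj c i p t
    pt with ≡-or-other (colour c p t) i
    ... | inj₁ e = p≁t , e
    ... | inj₂ e = ⊥-elim (no-common-neighbour far₂ (p≁t , e) (x≁t , xt))
    p't : ColAdj c i (partner p) t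
    p't with ≡-or-other (colour c (partner p) t) i
    ... | inj₁ e = p≁t , e
    ... | inj₂ e = ⊥-elim (no-common-neighbour far₃ (p≁t , e) (x≁t , x't))
    covers : ∀ v → PairAndCommon x i v ⊎ PairAndCommon p i v
    covers v with proj₁ x ≟ proj₁ v | proj₁ p ≟ proj₁ v
    ... | yes same | _ = inj₁ (inj₁ same)
    ... | no _ | yes same = inj₂ (inj₁ same)
    ... | no x≁v | no p≁v =
      Sum.map (λ (a , a') → inj₂ ((x≁v , a) , (x≁v , a'))) (λ (b , b') → inj₂ ((p≁v , b) , (p≁v , b')))
        (two-pairs-profile i _ _ _ _
          (λ (b , a') → no-common-neighbour far₁ (p≁v , b) (x≁v , a'))
          (λ (b , a) → no-common-neighbour far₂ (p≁v , b) (x≁v , a))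
          (λ (b' , a') → no-common-neighbour far₃ (p≁v , b') (x≁v , a'))
          (λ (b' , a) → no-common-neighbour far₄ (p≁v , b') (x≁v , a)))

  pair-neighbours-reach-partner : ∀ {x b w} i → ColAdj c i x b → ColAdj c i (partner x) (partner b) →
    ¬ Dist≤2 c (other i) b x → ¬ Dist≤2 c i (partner b) x →
    ColAdj c (other i) (partner x) w → ¬ Dist≤2 c i w (partner x) → CPAdj m w b →
    ∀ z → PairNeighbour b (other i) i z → Dist≤2 c (other i) z (partner b)
  pair-neighbours-reach-partner {x} {b} {w} i xb x'b' far-b far-b' x'w far-w w≁b z
    ((b≁z , bz) , b'z) with proj₁ x ≟ proj₁ z
  ... | no x≁z = ⊥-elim ([ (λ xz → no-common-neighbour far-b' b'z (x≁z , xz)) ,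
                           (λ xz → no-common-neighbour far-b (b≁z , bz) (x≁z , xz)) ]
                         (≡-or-other (colour c x z) i))
  ... | yes same with same-pair x z same
  ...   | inj₁ refl = ⊥-elim (≢-other i (trans (sym (proj₂ (ColAdj-sym xb))) bz))
  ...   | inj₂ refl = two-step x'w wb'
    where
    wb' : ColAdj c (other i) w (partner b)
    wb' with ≡-or-other (colour c w (partner b)) i
    ... | inj₁ e = ⊥-elim (no-common-neighbour far-w (w≁b , e) x'b')
    ... | inj₂ e = w≁b , e

  module _ (k : Fin m) where

    private
      x x' : V
      x = k , false
      x' = partner x

      c₁ c₂ : Fin 2
      c₁ = zero
      c₂ = suc zero

    cover-from-blockers : ∀ {z₁ z₂ z₃ z₄} →
      Blocker x c₁ z₁ → Blocker x c₂ z₂ → Blocker x' c₁ z₃ → Blocker x' c₂ z₄ →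
      ∃ (PairNeighbour x c₁ c₁) → ∃ (PairNeighbour x c₂ c₂) → TwoReachableCover
    cover-from-blockers {z₁} {z₄ = z₄}
      B₁@((_ , x'z₁) , far₁) B₂@((xz₂ , _) , far₂) B₃@((x'z₃ , _) , far₃) B₄@((_ , xz₄) , far₄)
      common₁ common₂
      with blockers-partnered B₁ B₂ | blockers-partnered B₄ B₃ | proj₁ z₁ ≟ proj₁ z₄
    ... | refl | refl | no z₁≁z₄ =
      cover-unless-blocker z₄ c₂
        (pair-neighbours-reach-partner c₁ xz₄ x'z₃ far₄ far₃ x'z₁ far₁ z₁≁z₄)
    ... | refl | refl | yes same with same-pair z₁ z₄ same
    ...   | inj₁ refl = cover-by-two-pairs c₁ xz₄ x'z₃ far₁ far₄ far₂ far₃ common₁ common₂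
    ...   | inj₂ z₄≡z₂ = ⊥-elim (different-colours⇒≢ (proj₂ xz₄) (proj₂ xz₂) z₄≡z₂)

    cover-around : TwoReachableCover
    cover-around with cover-or-pair-neighbour x c₁ | cover-or-pair-neighbour x c₂
    ... | inj₁ cover | _ = cover
    ... | inj₂ _ | inj₁ cover = cover
    ... | inj₂ common₁ | inj₂ common₂
      with cover-or-blocker x c₁ common₁ | cover-or-blocker x c₂ common₂
         | cover-or-blocker x' c₁ (map₂ swap common₁) | cover-or-blocker x' c₂ (map₂ swap common₂)
    ... | inj₁ cover | _ | _ | _ = cover
    ... | inj₂ _ | inj₁ cover | _ | _ = cover
    ... | inj₂ _ | inj₂ _ | inj₁ cover | _ = cover
    ... | inj₂ _ | inj₂ _ | inj₂ _ | inj₁ cover = cover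
    ... | inj₂ (_ , B₁) | inj₂ (_ , B₂) | inj₂ (_ , B₃) | inj₂ (_ , B₄) =
      cover-from-blockers B₁ B₂ B₃ B₄ common₁ common₂

theorem3 : (m : ℕ) → m ≥ 1 → (c : TwoColouring m) →
    Σ (VSubset m) λ A → Σ (VSubset m) λ B → Σ (Fin 2) λ i → Σ (Fin 2) λ j →
    (∀ v → A v ≡ true ⊎ B v ≡ true) × TwoReachable c i A × TwoReachable c j B
theorem3 (suc n) _ c = cover-around c zero
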